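{- For every integer $n\ge 1$ and every string $u$ of length $n$, the sum of the exponents of all cubic runs in $u$ is less than $2.5\,n$.
   Context: For a word $u=u_1\cdots u_m$, $u[i..j]=u_i\cdots u_j$. The shortest period of a word $x$ of length $m$ is the smallest positive integer $p$ with $x_i=x_{i+p}$ for all $1\le i\le m-p$. A run in $u$ is an interval $[i..j]$ such that the shortest period $p$ of $u[i..j]$ satisfies $2p\le j-i+1$ and (whenever the indices exist) $u[i-1]\ne u[i+p-1]$ and $u[j-p+1]\ne u[j+1]$. The exponent of such a run is $(j-i+1)/p$. A cubic run is a run $[i..j]$ whose shortest period $p$ satisfies $3p\le j-i+1$. Strings are over an arbitrary finite alphabet. -}

module Defs where

open import Data.Nat using (ℕ; zero; suc; _+_; _*_; _∸_; _≤_; _<?_)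
open import Data.Fin using (Fin; fromℕ<)
open import Data.Maybe using (Maybe; just; nothing)
open import Data.Product using (Σ; ∃; _×_; _,_)
open import Data.List using (List; map; foldr)
open import Data.List.Membership.Propositional using (_∈_)
open import Data.List.Relation.Unary.Unique.Propositional using (Unique)
open import Data.Integer using (+_)
open import Data.Rational using (ℚ; _/_; 0ℚ) renaming (_+_ to _+ℚ_)
open import Relation.Nullary using (¬_; yes; no)
open import Relation.Binary.PropositionalEquality using (_≡_)

Word : ℕ → ℕ → Set
Word k n = Fin n → Fin k

-- 1-based letter access: u[m] for 1 ≤ m ≤ n, and nothing otherwise.
letter : ∀ {k n} → Word k n → ℕ → Maybe (Fin k)
letter {n = n} u zero = nothing
letter {n = n} u (suc m) with m <? n
... | yes m<n = just (u (fromℕ< m<n))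
... | no _    = nothing

len : ℕ → ℕ → ℕ
len i j = suc j ∸ i

IsPeriod : ∀ {k n} → Word k n → ℕ → ℕ → ℕ → Set
IsPeriod u i j p = 1 ≤ p × (∀ t → i ≤ t → t + p ≤ j → letter u t ≡ letter u (t + p))

ShortestPeriod : ∀ {k n} → Word k n → ℕ → ℕ → ℕ → Set
ShortestPeriod u i j p = IsPeriod u i j p × (∀ q → IsPeriod u i j q → p ≤ q)

IsRunWithPeriod : ∀ {k n} → Word k n → ℕ → ℕ → ℕ → Set
IsRunWithPeriod {n = n} u i j p =
  1 ≤ i × i ≤ j × j ≤ n ×
  ShortestPeriod u i j p ×
  2 * p ≤ len i j ×
  (2 ≤ i → ¬ (letter u (i ∸ 1) ≡ letter u (i + p ∸ 1))) ×
  (suc j ≤ n → ¬ (letter u (suc j ∸ p) ≡ letter u (suc j)))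

IsCubicRunWithPeriod : ∀ {k n} → Word k n → ℕ → ℕ → ℕ → Set
IsCubicRunWithPeriod u i j p = IsRunWithPeriod u i j p × 3 * p ≤ len i j

-- exponent ℓ / p (p ≥ 1 for every run; the zero case never occurs)
ratio : ℕ → ℕ → ℚ
ratio ℓ zero    = 0ℚ
ratio ℓ (suc q) = (+ ℓ) / suc q

-- An interval (i , j) together with its shortest period p
Triple : Set
Triple = ℕ × ℕ × ℕ

exponentOf : Triple → ℚ
exponentOf (i , j , p) = ratio (len i j) p

sumℚ : List ℚ → ℚ
sumℚ = foldr _+ℚ_ 0ℚ

EnumeratesCubicRuns : ∀ {k n} → Word k n → List Triple → Set
EnumeratesCubicRuns u L =
  Unique L × (∀ i j p → ((i , j , p) ∈ L) → IsCubicRunWithPeriod u i j p)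
           × (∀ i j p → IsCubicRunWithPeriod u i j p → (i , j , p) ∈ L)

sumExponents : List Triple → ℚ
sumExponents L = sumℚ (map exponentOf L)

-- Code the letters as 1, 2, … and pad the word with the sentinel 0 on both sides, so that every run
-- is maximal through a mismatch on each side. A cubic run of period p picks one of the two
-- lexicographic orders: the one in which the letter after the run is smaller than the letter a period
-- before it. In that order the least rotation of the (primitive) period is a Lyndon word, and its
-- occurrences at multiples of p after the start of the run give ⌊e⌋ - 1 ≥ e / 2 Lyndon roots, e being
-- the exponent. No position is a Lyndon root of two cubic runs: with the same order, the longer root
-- is not smaller than its suffix one shorter period later; with opposite orders, the suffix one letter
-- later cannot exceed both roots; and equal periods force equal runs by maximality. The roots lie in
-- 1 … n, so the exponents sum to at most 2 n < 5 n / 2.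

module Submission where

open import Defs

open import Data.Bool using (Bool; true; false)
open import Data.Bool.Properties using () renaming (_≟_ to _≟ᵇ_)
open import Data.Empty using (⊥; ⊥-elim)
open import Data.Fin using (Fin; zero; suc; toℕ; fromℕ<)
open import Data.Fin.Properties using (injective⇒≤; toℕ-injective; toℕ-fromℕ<)
open import Data.Integer using (+≤+; +<+)
import Data.Integer as ℤ
import Data.Integer.Properties as ℤᴾ
open import Data.List using (List; []; _∷_; _++_; length; map; upTo; lookup)
open import Data.List.Properties using (length-map; length-upTo; length-++)
open import Data.List.Membership.Propositional using (_∈_)
open import Data.List.Membership.Propositional.Properties using (∈-upTo⁻; ∈-lookup)
open import Data.List.Relation.Unary.All as All using (All)
import Data.List.Relation.Unary.All.Properties as All
open import Data.List.Relation.Unary.AllPairs using ([]; _∷_)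
open import Data.List.Relation.Unary.Any using (here; there)
open import Data.List.Relation.Unary.Unique.Propositional using (Unique)
import Data.List.Relation.Unary.Unique.Propositional.Properties as Unique
open import Data.Maybe using (Maybe; just; nothing)
open import Data.Nat
open import Data.Nat.DivMod using (_%_; _/_; m%n<n; m≡m%n+[m/n]*n; m/n*n≤m; m*n/n≡m; /-monoˡ-≤)
open import Data.Nat.Properties
open import Data.Nat.Tactic.RingSolver using (solve-∀)
open import Algebra.Properties.CommutativeSemigroup +-commutativeSemigroup using (xy∙z≈xz∙y)
open import Data.Product using (∃; _×_; _,_; proj₁)
open import Data.Rational using (ℚ; toℚᵘ)
import Data.Rational as ℚ
import Data.Rational.Properties as ℚᴾ
open import Data.Rational.Unnormalised using (ℚᵘ; mkℚᵘ; *≤*; *<*; *≡*)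
import Data.Rational.Unnormalised as ℚᵘ
import Data.Rational.Unnormalised.Properties as ℚᵘᴾ
open import Data.Sum using (_⊎_; inj₁; inj₂)
import Data.Sum as Sum
open import Function using (_∘_)
open import Relation.Binary.Definitions using (tri<; tri≈; tri>)
open import Relation.Binary.PropositionalEquality
open import Relation.Nullary using (¬_; yes; no)
open import Relation.Nullary.Reflects using (ofʸ; ofⁿ)

private variable
  a a′ c c′ d i i′ j j′ ℓ ℓ′ p p′ s t t′ x y z : ℕ
  b b′ : Bool

_<[_]_ : ℕ → Bool → ℕ → Set
x <[ true  ] y = x < y
x <[ false ] y = y < x

<[]-irrefl : ∀ b → ¬ x <[ b ] x
<[]-irrefl true  = <-irrefl refl
<[]-irrefl false = <-irrefl refl

<[]-trans : ∀ b → x <[ b ] y → y <[ b ] z → x <[ b ] z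
<[]-trans true  x<y y<z = <-trans x<y y<z
<[]-trans false y<x z<y = <-trans z<y y<x

<[]-asym : ∀ b → x <[ b ] y → ¬ y <[ b ] x
<[]-asym b x<y y<x = <[]-irrefl b (<[]-trans b x<y y<x)

<[]-cmp : ∀ b → x ≢ y → x <[ b ] y ⊎ y <[ b ] x
<[]-cmp {x} {y} true x≢y with <-cmp x y
... | tri< x<y _ _ = inj₁ x<y
... | tri≈ _ x≡y _ = ⊥-elim (x≢y x≡y)
... | tri> _ _ y<x = inj₂ y<x
<[]-cmp false x≢y = Sum.swap (<[]-cmp true x≢y)

<[]-opposite : b ≢ b′ → x <[ b ] y → ¬ x <[ b′ ] y
<[]-opposite {true}  {true}  b≢b′ _ _ = b≢b′ refl
<[]-opposite {true}  {false} _ x<y y<x = <-asym x<y y<x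
<[]-opposite {false} {true}  _ y<x x<y = <-asym x<y y<x
<[]-opposite {false} {false} b≢b′ _ _ = b≢b′ refl

<[]-<ᵇ : x ≢ y → x <[ x <ᵇ y ] y
<[]-<ᵇ {x} {y} x≢y with x <ᵇ y | <ᵇ-reflects-< x y
... | true  | ofʸ x<y = x<y
... | false | ofⁿ x≮y = ≤∧≢⇒< (≮⇒≥ x≮y) (x≢y ∘ sym)

m+n+o≡q⇒m+o≡q∸n : ∀ m n o {q} → m + n + o ≡ q → m + o ≡ q ∸ n
m+n+o≡q⇒m+o≡q∸n m n o refl = trans (sym (m+n∸n≡m (m + o) n)) (cong (_∸ n) (xy∙z≈xz∙y m o n))

module Factors (w : ℕ → ℕ) where

  Agree : ℕ → ℕ → ℕ → Set
  Agree a c ℓ = ∀ e → e < ℓ → w (a + e) ≡ w (c + e)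

  agree-sym : Agree a c ℓ → Agree c a ℓ
  agree-sym eq e e<ℓ = sym (eq e e<ℓ)

  agree-≤ : d ≤ ℓ → Agree a c ℓ → Agree a c d
  agree-≤ d≤ℓ eq e e<d = eq e (<-≤-trans e<d d≤ℓ)

  agree-drop : Agree a c (d + ℓ) → Agree (a + d) (c + d) ℓ
  agree-drop {a} {c} {d} eq e e<ℓ =
    subst₂ (λ x y → w x ≡ w y) (sym (+-assoc a d e)) (sym (+-assoc c d e)) (eq (d + e) (+-monoʳ-< d e<ℓ))

  agree-or-mismatch : ∀ a c ℓ → Agree a c ℓ ⊎ ∃ λ d → d < ℓ × Agree a c d × w (a + d) ≢ w (c + d)
  agree-or-mismatch a c zero = inj₁ (λ _ ())
  agree-or-mismatch a c (suc ℓ) with agree-or-mismatch a c ℓ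
  ... | inj₂ (d , d<ℓ , eq , ne) = inj₂ (d , m<n⇒m<1+n d<ℓ , eq , ne)
  ... | inj₁ eq with w (a + ℓ) ≟ w (c + ℓ)
  ...   | no ne = inj₂ (ℓ , n<1+n ℓ , eq , ne)
  ...   | yes eqℓ = inj₁ λ e e<1+ℓ → Sum.[ eq e , (λ { refl → eqℓ }) ] (m<1+n⇒m<n∨m≡n e<1+ℓ)

  LexLess : Bool → ℕ → ℕ → ℕ → Set
  LexLess b ℓ a c = ∃ λ d → d < ℓ × Agree a c d × w (a + d) <[ b ] w (c + d)

  lexLess-agree : Agree a c ℓ → ¬ LexLess b ℓ a c
  lexLess-agree {a} {c} {b = b} eq (d , d<ℓ , _ , lt) =
    <[]-irrefl b (subst (_<[ b ] w (c + d)) (eq d d<ℓ) lt)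

  lexLess-irrefl : ¬ LexLess b ℓ a a
  lexLess-irrefl = lexLess-agree (λ _ _ → refl)

  lexLess-trans : LexLess b ℓ a c → LexLess b ℓ c c′ → LexLess b ℓ a c′
  lexLess-trans {b} {a = a} {c′ = c′} (d , d<ℓ , eq , lt) (d′ , d′<ℓ , eq′ , lt′) with <-cmp d d′
  ... | tri< d<d′ _ _ =
    d , d<ℓ , (λ e e<d → trans (eq e e<d) (eq′ e (<-trans e<d d<d′))) ,
    subst (w (a + d) <[ b ]_) (eq′ d d<d′) lt
  ... | tri≈ _ refl _ = d , d<ℓ , (λ e e<d → trans (eq e e<d) (eq′ e e<d)) , <[]-trans b lt lt′
  ... | tri> _ _ d′<d =
    d′ , d′<ℓ , (λ e e<d′ → trans (eq e (<-trans e<d′ d′<d)) (eq′ e e<d′)) ,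
    subst (_<[ b ] w (c′ + d′)) (sym (eq d′ d′<d)) lt′

  lexLess-asym : LexLess b ℓ a c → ¬ LexLess b ℓ c a
  lexLess-asym a<c c<a = lexLess-irrefl (lexLess-trans a<c c<a)

  lexLess-cmp : ∀ b ℓ a c → LexLess b ℓ a c ⊎ LexLess b ℓ c a ⊎ Agree a c ℓ
  lexLess-cmp b ℓ a c with agree-or-mismatch a c ℓ
  ... | inj₁ eq = inj₂ (inj₂ eq)
  ... | inj₂ (d , d<ℓ , eq , ne) with <[]-cmp b ne
  ...   | inj₁ lt = inj₁ (d , d<ℓ , eq , lt)
  ...   | inj₂ gt = inj₂ (inj₁ (d , d<ℓ , agree-sym eq , gt))

  lexLess-resp : Agree a a′ ℓ → Agree c c′ ℓ → LexLess b ℓ a c → LexLess b ℓ a′ c′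
  lexLess-resp {b = b} aa′ cc′ (d , d<ℓ , eq , lt) =
    d , d<ℓ ,
    (λ e e<d → trans (sym (aa′ e (<-trans e<d d<ℓ))) (trans (eq e e<d) (cc′ e (<-trans e<d d<ℓ)))) ,
    subst₂ (_<[ b ]_) (aa′ d d<ℓ) (cc′ d d<ℓ) lt

  lexLess-opposite : b ≢ b′ → LexLess b ℓ a c → ¬ LexLess b′ ℓ′ a c
  lexLess-opposite {b} {b′} {c = c} b≢b′ (d , _ , eq , lt) (d′ , _ , eq′ , lt′) with <-cmp d d′
  ... | tri< d<d′ _ _ = <[]-irrefl b (subst (_<[ b ] w (c + d)) (eq′ d d<d′) lt)
  ... | tri≈ _ refl _ = <[]-opposite b≢b′ lt lt′
  ... | tri> _ _ d′<d = <[]-irrefl b′ (subst (_<[ b′ ] w (c + d′)) (eq d′ d′<d) lt′)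

  lexMin : ∀ b ℓ a N → ∃ λ x → x ≤ N × ∀ y → y ≤ N → ¬ LexLess b ℓ (a + y) (a + x)
  lexMin b ℓ a zero = 0 , z≤n , λ { zero _ → lexLess-irrefl }
  lexMin b ℓ a (suc N) with lexMin b ℓ a N
  ... | x , x≤N , least with lexLess-cmp b ℓ (a + suc N) (a + x)
  ...   | inj₁ new<x = suc N , ≤-refl , λ y y≤1+N y<new →
    Sum.[ (λ y≤N → least y (≤-pred y≤N) (lexLess-trans y<new new<x)) , (λ { refl → lexLess-irrefl y<new }) ]
      (m≤n⇒m<n∨m≡n y≤1+N)
  ...   | inj₂ x≤new = x , m≤n⇒m≤1+n x≤N , λ y y≤1+N y<x →
    Sum.[ (λ y≤N → least y (≤-pred y≤N) y<x) , (λ { refl → not-below x≤new y<x }) ] (m≤n⇒m<n∨m≡n y≤1+N)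
    where
      not-below : LexLess b ℓ (a + x) (a + suc N) ⊎ Agree (a + suc N) (a + x) ℓ →
                  ¬ LexLess b ℓ (a + suc N) (a + x)
      not-below (inj₁ x<new) = lexLess-asym x<new
      not-below (inj₂ eq)    = lexLess-agree eq

  Lyndon : Bool → ℕ → ℕ → Set
  Lyndon b t ℓ = ∀ d → 0 < d → d < ℓ → LexLess b (ℓ ∸ d) t (t + d)

  lyndon-resp : Agree t t′ ℓ → Lyndon b t ℓ → Lyndon b t′ ℓ
  lyndon-resp {t} {t′} {ℓ} eq lyndon d 0<d d<ℓ =
    lexLess-resp (agree-≤ (m∸n≤m ℓ d) eq)
                 (agree-drop (subst (Agree t t′) (sym (m+[n∸m]≡n (<⇒≤ d<ℓ))) eq))
                 (lyndon d 0<d d<ℓ)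

  lyndon-first<last : Lyndon b t ℓ → 1 < ℓ → w t <[ b ] w (t + (ℓ ∸ 1))
  lyndon-first<last {b} {t} {ℓ} lyndon 1<ℓ with lyndon (ℓ ∸ 1) (m<n⇒0<n∸m 1<ℓ) (∸-monoʳ-< z<s (<⇒≤ 1<ℓ))
  ... | d , d<1 , _ , lt with n<1⇒n≡0 (subst (d <_) (m∸[m∸n]≡n (<⇒≤ 1<ℓ)) d<1)
  ... | refl = subst₂ (_<[ b ]_) (cong w (+-identityʳ t)) (cong w (+-identityʳ _)) lt

  leastRotation⇒lyndon : Agree t (t + p) p → (∀ d → 0 < d → d < p → LexLess b p t (t + d)) →
                         Lyndon b t p
  leastRotation⇒lyndon {t} {p} {b} periodic least d 0<d d<p with least d 0<d d<p
  ... | e , e<p , eq , lt with e <? p ∸ d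
  ...   | yes e<p∸d = e , e<p∸d , eq , lt
  ...   | no  e≮p∸d with m≤n⇒∃[o]m+o≡n (≮⇒≥ e≮p∸d)
  ...     | f , refl = ⊥-elim (lexLess-asym (least k (m<n⇒0<n∸m d<p) (∸-monoʳ-< 0<d (<⇒≤ d<p)))
                                            (f , f<p , wrapped-agree , wrapped-lt))
    where
      -- the mismatch lies beyond the suffix at t + d, so it wraps around to the rotation at t + k
      k : ℕ
      k = p ∸ d
      f<p : f < p
      f<p = ≤-<-trans (m≤n+m f k) e<p
      reassoc : ∀ t d k x → t + d + (k + x) ≡ t + (d + k) + x
      reassoc = solve-∀
      cycle : ∀ x → x < p → w (t + d + (k + x)) ≡ w (t + x)
      cycle x x<p = trans (cong w (trans (reassoc t d k x) (cong (λ q → t + q + x) (m+[n∸m]≡n (<⇒≤ d<p)))))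
                          (sym (periodic x x<p))
      wrapped-agree : Agree (t + k) t f
      wrapped-agree x x<f =
        trans (cong w (+-assoc t k x)) (trans (eq (k + x) (+-monoʳ-< k x<f)) (cycle x (<-trans x<f f<p)))
      wrapped-lt : w (t + k + f) <[ b ] w (t + f)
      wrapped-lt = subst₂ (_<[ b ]_) (cong w (sym (+-assoc t k f))) (cycle f f<p) lt

module Runs (w : ℕ → ℕ) where

  open Factors w

  HasPeriod : ℕ → ℕ → ℕ → Set
  HasPeriod i j q = ∀ x → i ≤ x → x + q ≤ j → w x ≡ w (x + q)

  record CubicRun (i j p : ℕ) : Set where
    field
      period-pos    : 0 < p
      cubic         : i + 3 * p ≤ suc j
      periodic      : HasPeriod i j p
      least-period  : ∀ q → 0 < q → q < p → ¬ HasPeriod i j q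
      left-maximal  : w (i ∸ 1) ≢ w (i ∸ 1 + p)
      right-maximal : w (suc j ∸ p) ≢ w (suc j)

  runOrder : ℕ → ℕ → Bool
  runOrder j p = w (suc j) <ᵇ w (suc j ∸ p)

  LyndonRoot : ℕ → ℕ → ℕ → ℕ → Set
  LyndonRoot i j p t = i < t × t + p ≤ suc j × Lyndon (runOrder j p) t p

  LyndonRootOf : Triple → ℕ → Set
  LyndonRootOf (i , j , p) = LyndonRoot i j p

  module _ {i j p : ℕ} (run : CubicRun i j p) where

    open CubicRun run

    instance
      p-nonZero : NonZero p
      p-nonZero = >-nonZero period-pos

    within-run : x < i + p + p + p → x ≤ j
    within-run x<end = ≤-pred (≤-trans x<end (subst (_≤ suc j) (three-periods i p) cubic))
      where
        three-periods : ∀ i p → i + 3 * p ≡ i + p + p + p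
        three-periods = solve-∀

    periodic-agree : i ≤ x → x ≤ i + p → Agree x (x + p) p
    periodic-agree {x} i≤x x≤i+p e e<p =
      trans (periodic (x + e) (≤-trans i≤x (m≤m+n x e)) (within-run (+-monoˡ-< p (+-mono-≤-< x≤i+p e<p))))
            (cong w (xy∙z≈xz∙y x e p))

    periodic-multiple : ∀ k → i ≤ x → x + k * p ≤ j → w x ≡ w (x + k * p)
    periodic-multiple {x} zero _ _ = cong w (sym (+-identityʳ x))
    periodic-multiple {x} (suc k) i≤x x+kp≤j =
      trans (periodic x i≤x (≤-trans (m≤m+n (x + p) (k * p)) bound))
            (trans (periodic-multiple k (≤-trans i≤x (m≤m+n x p)) bound) (cong w (+-assoc x p (k * p))))
      where
        bound : x + p + k * p ≤ j
        bound = subst (_≤ j) (sym (+-assoc x p (k * p))) x+kp≤j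

    periodic-shift : ∀ q → i ≤ x → x ≤ j → i ≤ y → y ≤ j → x + p ≡ y + q * p → w x ≡ w y
    periodic-shift {x} {y} zero i≤x _ _ y≤j x+p≡y =
      trans (periodic x i≤x (subst (_≤ j) (sym x+p≡y′) y≤j)) (cong w x+p≡y′)
      where
        x+p≡y′ : x + p ≡ y
        x+p≡y′ = trans x+p≡y (+-identityʳ y)
    periodic-shift {x} {y} (suc q) _ x≤j i≤y _ x+p≡y+p+qp =
      sym (trans (periodic-multiple q i≤y (subst (_≤ j) (sym y+qp≡x) x≤j)) (cong w y+qp≡x))
      where
        rearrange : ∀ y p qp → y + (p + qp) ≡ y + qp + p
        rearrange = solve-∀
        y+qp≡x : y + q * p ≡ x
        y+qp≡x = sym (+-cancelʳ-≡ p x (y + q * p) (trans x+p≡y+p+qp (rearrange y p (q * p))))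

    -- a rotation of the period equal to the period itself would make d a period of the whole run
    rotation-distinct : i ≤ t → t ≤ i + p → 0 < d → d < p → ¬ Agree (t + d) t p
    rotation-distinct {t} {d} i≤t t≤i+p 0<d d<p rotation≡ = least-period d 0<d d<p d-period
      where
        d-period : HasPeriod i j d
        d-period x i≤x x+d≤j =
          begin
            w x           ≡⟨ periodic-shift q i≤x (≤-trans (m≤m+n x d) x+d≤j) (≤-trans i≤t (m≤m+n t r))
                               (within-run (≤-trans (+-mono-≤-< t≤i+p r<p) (m≤m+n _ p))) x-split ⟩
            w (t + r)     ≡⟨ rotation≡ r r<p ⟨
            w (t + d + r) ≡⟨ periodic-shift q (≤-trans i≤x (m≤m+n x d)) x+d≤j
                               (≤-trans i≤t (≤-trans (m≤m+n t d) (m≤m+n (t + d) r)))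
                               (within-run (+-mono-<-≤ (+-mono-≤-< t≤i+p d<p) (<⇒≤ r<p))) x+d-split ⟨
            w (x + d)     ∎
          where
            open ≡-Reasoning
            n r q : ℕ
            n = x + p ∸ t
            r = n % p
            q = n / p
            r<p : r < p
            r<p = m%n<n n p
            x-split : x + p ≡ t + r + q * p
            x-split = begin
              x + p                 ≡⟨ m+[n∸m]≡n (≤-trans t≤i+p (+-monoˡ-≤ p i≤x)) ⟨
              t + n                 ≡⟨ cong (t +_) (m≡m%n+[m/n]*n n p) ⟩
              t + (r + q * p)       ≡⟨ +-assoc t r (q * p) ⟨
              t + r + q * p         ∎
            rearrange : ∀ x d p t r qp → x + p + d ≡ t + r + qp + d → x + d + p ≡ t + d + r + qp
            rearrange x d p t r qp eq = trans (xy∙z≈xz∙y x d p) (trans eq (lemma t r qp d))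
              where
                lemma : ∀ t r qp d → t + r + qp + d ≡ t + d + r + qp
                lemma = solve-∀
            x+d-split : x + d + p ≡ t + d + r + q * p
            x+d-split = rearrange x d p t r (q * p) (cong (_+ d) x-split)

    rotation-reduce : i < s → s < i + p + p → ∃ λ s′ → i < s′ × s′ ≤ i + p × Agree s′ s p
    rotation-reduce {s} i<s s<end with s ≤? i + p
    ... | yes s≤i+p = s , i<s , s≤i+p , λ _ _ → refl
    ... | no  s≰i+p =
      s ∸ p , i<s′ , s′≤i+p , subst (λ z → Agree (s ∸ p) z p) s′+p≡s (periodic-agree (<⇒≤ i<s′) s′≤i+p)
      where
        s′+p≡s : s ∸ p + p ≡ s
        s′+p≡s = m∸n+n≡m (≤-trans (m≤n+m p i) (<⇒≤ (≰⇒> s≰i+p)))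
        i<s′ : i < s ∸ p
        i<s′ = +-cancelʳ-< p i (s ∸ p) (subst (i + p <_) (sym s′+p≡s) (≰⇒> s≰i+p))
        s′≤i+p : s ∸ p ≤ i + p
        s′≤i+p = <⇒≤ (+-cancelʳ-< p (s ∸ p) (i + p) (subst (_< i + p + p) (sym s′+p≡s) s<end))

    -- the least rotation of the period, taken at a start in (i, i + p]
    lyndonRoot-exists : ∀ b → ∃ λ t → i < t × t ≤ i + p × Lyndon b t p
    lyndonRoot-exists b with lexMin b p (suc i) (pred p)
    ... | x , x≤pred , least =
      t₀ , i<t₀ , t₀≤i+p , leastRotation⇒lyndon (periodic-agree (<⇒≤ i<t₀) t₀≤i+p) strictly-least
      where
        t₀ : ℕ
        t₀ = suc i + x
        i<t₀ : i < t₀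
        i<t₀ = s≤s (m≤m+n i x)
        t₀≤i+p : t₀ ≤ i + p
        t₀≤i+p = subst (_≤ i + p) (+-suc i x) (+-monoʳ-≤ i (subst (suc x ≤_) (suc-pred p) (s≤s x≤pred)))
        least-rotation : ∀ s → i < s → s ≤ i + p → ¬ LexLess b p s t₀
        least-rotation s i<s s≤i+p with m≤n⇒∃[o]m+o≡n i<s
        ... | y , refl = least y (<⇒≤pred (+-cancelˡ-< i y p s≤i+p))
        strictly-least : ∀ d → 0 < d → d < p → LexLess b p t₀ (t₀ + d)
        strictly-least d 0<d d<p with lexLess-cmp b p t₀ (t₀ + d)
        ... | inj₁ t₀<t₀+d = t₀<t₀+d
        ... | inj₂ (inj₂ t₀≈t₀+d) = ⊥-elim (rotation-distinct (<⇒≤ i<t₀) t₀≤i+p 0<d d<p (agree-sym t₀≈t₀+d))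
        ... | inj₂ (inj₁ t₀+d<t₀) with rotation-reduce (<-≤-trans i<t₀ (m≤m+n t₀ d)) (+-mono-≤-< t₀≤i+p d<p)
        ...   | s , i<s , s≤i+p , s≈t₀+d =
          ⊥-elim (least-rotation s i<s s≤i+p (lexLess-resp (agree-sym s≈t₀+d) (λ _ _ → refl) t₀+d<t₀))

    three-periods : 3 ≤ len i j / p
    three-periods = subst (_≤ len i j / p) (m*n/n≡m 3 p)
                          (/-monoˡ-≤ p (subst (_≤ len i j) (m+n∸m≡n i (3 * p)) (∸-monoˡ-≤ i cubic)))

    -- the roots t₀, t₀ + p, …, t₀ + (⌊e⌋ - 2) p all fit in the run, and ⌊e⌋ - 1 ≥ e / 2 as e ≥ 3
    lyndonRoots : ∃ λ ts → Unique ts × All (LyndonRoot i j p) ts × len i j ≤ 2 * length ts * p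
    lyndonRoots with lyndonRoot-exists (runOrder j p) | m≤n⇒∃[o]m+o≡n three-periods
    ... | t₀ , i<t₀ , t₀≤i+p , lyndon | c , 3+c≡q = roots , unique , all-roots , length-bound
      where
        root : ℕ → ℕ
        root k = t₀ + k * p
        roots : List ℕ
        roots = map root (upTo (2 + c))
        unique : Unique roots
        unique = Unique.map⁺ (λ {k} {k′} eq → *-cancelʳ-≡ k k′ p (+-cancelˡ-≡ t₀ (k * p) (k′ * p) eq))
                             (Unique.upTo⁺ (2 + c))
        root-fits : ∀ k → k < 2 + c → root k + p ≤ suc j
        root-fits k k<2+c = begin
          t₀ + k * p + p        ≤⟨ +-monoˡ-≤ p (+-monoˡ-≤ (k * p) t₀≤i+p) ⟩
          i + p + k * p + p     ≡⟨ rearrange i p (k * p) ⟩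
          i + (2 + k) * p       ≤⟨ +-monoʳ-≤ i (*-monoˡ-≤ p (subst (2 + k ≤_) 3+c≡q (s≤s k<2+c))) ⟩
          i + len i j / p * p   ≤⟨ +-monoʳ-≤ i (m/n*n≤m (len i j) p) ⟩
          i + len i j           ≡⟨ m+[n∸m]≡n (≤-trans (m≤m+n i (3 * p)) cubic) ⟩
          suc j                 ∎
          where
            open ≤-Reasoning
            rearrange : ∀ i p kp → i + p + kp + p ≡ i + (p + (p + kp))
            rearrange = solve-∀
        root-lyndon : ∀ k → k < 2 + c → Lyndon (runOrder j p) (root k) p
        root-lyndon k k<2+c = lyndon-resp same lyndon
          where
            same : Agree t₀ (root k) p
            same e e<p = trans (periodic-multiple k (≤-trans (<⇒≤ i<t₀) (m≤m+n t₀ e)) (≤-pred before-end))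
                               (cong w (xy∙z≈xz∙y t₀ e (k * p)))
              where
                before-end : t₀ + e + k * p < suc j
                before-end = ≤-trans (subst (_< root k + p) (xy∙z≈xz∙y t₀ (k * p) e) (+-monoʳ-< (root k) e<p))
                                     (root-fits k k<2+c)
        all-roots : All (LyndonRoot i j p) roots
        all-roots = All.map⁺ (All.tabulate λ {k} k∈ →
          <-≤-trans i<t₀ (m≤m+n t₀ (k * p)) , root-fits k (∈-upTo⁻ k∈) , root-lyndon k (∈-upTo⁻ k∈))
        length-bound : len i j ≤ 2 * length roots * p
        length-bound = begin
          len i j                             ≡⟨ m≡m%n+[m/n]*n (len i j) p ⟩
          len i j % p + len i j / p * p       ≤⟨ +-monoˡ-≤ (len i j / p * p) (<⇒≤ (m%n<n (len i j) p)) ⟩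
          (1 + len i j / p) * p               ≡⟨ cong (λ q → (1 + q) * p) (sym 3+c≡q) ⟩
          (4 + c) * p                         ≤⟨ *-monoˡ-≤ p (subst (4 + c ≤_) (double c) 4+c≤4+2c) ⟩
          2 * (2 + c) * p                     ≡⟨ cong (λ m → 2 * m * p) length-roots ⟨
          2 * length roots * p                ∎
          where
            open ≤-Reasoning
            4+c≤4+2c : 4 + c ≤ 4 + (c + c)
            4+c≤4+2c = +-monoʳ-≤ 4 (m≤n+m c c)
            double : ∀ c → 4 + (c + c) ≡ 2 * (2 + c)
            double = solve-∀
            length-roots : length roots ≡ 2 + c
            length-roots = trans (length-map root (upTo (2 + c))) (length-upTo (2 + c))

    runOrder-after : w (suc j) <[ runOrder j p ] w (suc j ∸ p)
    runOrder-after = <[]-<ᵇ (right-maximal ∘ sym)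

    -- a factor and its shift by p first differ past the end of the run, where the run order decides
    shift-not-smaller : i ≤ t → t + p ≤ suc j → ¬ LexLess (runOrder j p) ℓ t (t + p)
    shift-not-smaller {t} i≤t t+p≤1+j (d , _ , eq , lt) with m≤n⇒∃[o]m+o≡n t+p≤1+j
    ... | e , t+p+e≡1+j with <-cmp d e
    ... | tri< d<e _ _ =
      <[]-irrefl (runOrder j p) (subst (_<[ runOrder j p ] w (t + p + d)) periodic-at-d lt)
      where
        periodic-at-d : w (t + d) ≡ w (t + p + d)
        periodic-at-d =
          trans (periodic (t + d) (≤-trans i≤t (m≤m+n t d))
                  (≤-pred (subst (t + d + p <_) t+p+e≡1+j
                    (subst (_< t + p + e) (xy∙z≈xz∙y t p d) (+-monoʳ-< (t + p) d<e)))))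
                (cong w (xy∙z≈xz∙y t d p))
    ... | tri≈ _ refl _ =
      <[]-asym (runOrder j p) runOrder-after
        (subst₂ (_<[ runOrder j p ]_) (cong w (m+n+o≡q⇒m+o≡q∸n t p d t+p+e≡1+j)) (cong w t+p+e≡1+j) lt)
    ... | tri> _ _ e<d =
      right-maximal (subst₂ (λ x y → w x ≡ w y) (m+n+o≡q⇒m+o≡q∸n t p e t+p+e≡1+j) t+p+e≡1+j (eq e e<d))

  runs-start-together : CubicRun i j p → CubicRun i′ j′ p → i < t → t + p ≤ suc j → i′ < t → ¬ i < i′
  runs-start-together {p = p} {i′ = suc i″} {t = t} run run′ i<t t+p≤1+j i′<t i<i′ =
    CubicRun.left-maximal run′ (CubicRun.periodic run i″ (≤-pred i<i′) (≤-pred (<-≤-trans i″+p<t+p t+p≤1+j)))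
    where
      i″+p<t+p : i″ + p < t + p
      i″+p<t+p = +-monoˡ-< p (<-trans (n<1+n i″) i′<t)

  runs-end-together : CubicRun i j p → CubicRun i′ j′ p → i′ < t → t + p ≤ suc j → ¬ j < j′
  runs-end-together {j = j} {p} {i′} {j′} {t} run run′ i′<t t+p≤1+j j<j′ =
    CubicRun.right-maximal run
      (trans (CubicRun.periodic run′ (suc j ∸ p) i′≤ (subst (_≤ j′) (sym shift-back) j<j′)) (cong w shift-back))
    where
      shift-back : suc j ∸ p + p ≡ suc j
      shift-back = m∸n+n≡m (≤-trans (m≤n+m p t) t+p≤1+j)
      i′≤ : i′ ≤ suc j ∸ p
      i′≤ = ≤-trans (<⇒≤ i′<t) (subst (_≤ suc j ∸ p) (m+n∸n≡m t p) (∸-monoˡ-≤ p t+p≤1+j))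

  runs-equal : CubicRun i j p → CubicRun i′ j′ p → i < t → t + p ≤ suc j → i′ < t → t + p ≤ suc j′ →
               i ≡ i′ × j ≡ j′
  runs-equal {i} {j} {i′ = i′} {j′} run run′ i<t t+p≤1+j i′<t t+p≤1+j′ = starts , ends
    where
      starts : i ≡ i′
      starts with <-cmp i i′
      ... | tri< i<i′ _ _ = ⊥-elim (runs-start-together run run′ i<t t+p≤1+j i′<t i<i′)
      ... | tri≈ _ i≡i′ _ = i≡i′
      ... | tri> _ _ i′<i = ⊥-elim (runs-start-together run′ run i′<t t+p≤1+j′ i<t i′<i)
      ends : j ≡ j′
      ends with <-cmp j j′
      ... | tri< j<j′ _ _ = ⊥-elim (runs-end-together run run′ i′<t t+p≤1+j j<j′)
      ... | tri≈ _ j≡j′ _ = j≡j′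
      ... | tri> _ _ j′<j = ⊥-elim (runs-end-together run′ run i<t t+p≤1+j′ j′<j)

  same-order-shorter : CubicRun i j p → LyndonRoot i j p t → LyndonRoot i′ j′ p′ t →
                       runOrder j p ≡ runOrder j′ p′ → ¬ p < p′
  same-order-shorter {p = p} {t} {p′ = p′} run (i<t , t+p≤1+j , _) (_ , _ , lyndon′) same p<p′ =
    shift-not-smaller run (<⇒≤ i<t) t+p≤1+j
      (subst (λ b → LexLess b (p′ ∸ p) t (t + p)) (sym same) (lyndon′ p (CubicRun.period-pos run) p<p′))

  -- w (t - 1) = w t by period 1 and w (t - 1) = w (t + p′ - 1) by period p′, but a Lyndon word of
  -- length p′ ≥ 2 starts with a letter smaller than its last one
  period-one-shorter : CubicRun i j 1 → LyndonRoot i j 1 t → CubicRun i′ j′ p′ → LyndonRoot i′ j′ p′ t →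
                       ¬ 1 < p′
  period-one-shorter {t = suc t′} {j′ = j′} {p′ = suc q}
                     run (i<t , t+1≤1+j , _) run′ (i′<t , t+p′≤1+j′ , lyndon′) 1<p′ =
    <[]-irrefl order (subst (_<[ order ] w (suc t′ + q)) first≡last (lyndon-first<last lyndon′ 1<p′))
    where
      order : Bool
      order = runOrder j′ (suc q)
      first≡last : w (suc t′) ≡ w (suc t′ + q)
      first≡last = begin
        w (suc t′)     ≡⟨ cong w (+-comm 1 t′) ⟩
        w (t′ + 1)     ≡⟨ CubicRun.periodic run t′ (≤-pred i<t) (≤-pred t+1≤1+j) ⟨
        w t′           ≡⟨ CubicRun.periodic run′ t′ (≤-pred i′<t) (≤-pred t+p′≤1+j′) ⟩
        w (t′ + suc q) ≡⟨ cong w (+-suc t′ q) ⟩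
        w (suc t′ + q) ∎
        where open ≡-Reasoning

  -- for p ≥ 2 both roots are smaller than their suffix at t + 1, in opposite orders
  opposite-orders-shorter : CubicRun i j p → LyndonRoot i j p t → CubicRun i′ j′ p′ → LyndonRoot i′ j′ p′ t →
                            runOrder j p ≢ runOrder j′ p′ → ¬ p < p′
  opposite-orders-shorter {p = zero} run _ _ _ _ _ = <-irrefl refl (CubicRun.period-pos run)
  opposite-orders-shorter {p = suc zero} run root run′ root′ _ 1<p′ =
    period-one-shorter run root run′ root′ 1<p′
  opposite-orders-shorter {p = suc (suc _)} _ (_ , _ , lyndon) _ (_ , _ , lyndon′) different p<p′ =
    lexLess-opposite different (lyndon 1 z<s (s≤s (s≤s z≤n))) (lyndon′ 1 z<s (<-trans (s≤s (s≤s z≤n)) p<p′))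

  shorter-root-impossible : CubicRun i j p → LyndonRoot i j p t → CubicRun i′ j′ p′ → LyndonRoot i′ j′ p′ t →
                            ¬ p < p′
  shorter-root-impossible {j = j} {p} {j′ = j′} {p′} run root run′ root′ with runOrder j p ≟ᵇ runOrder j′ p′
  ... | yes same      = same-order-shorter run root root′ same
  ... | no  different = opposite-orders-shorter run root run′ root′ different

  lyndonRoot-unique : CubicRun i j p → LyndonRoot i j p t → CubicRun i′ j′ p′ → LyndonRoot i′ j′ p′ t →
                      (i , j , p) ≡ (i′ , j′ , p′)
  lyndonRoot-unique {p = p} {p′ = p′} run root@(i<t , t+p≤1+j , _) run′ root′@(i′<t , t+p≤1+j′ , _)
    with <-cmp p p′
  ... | tri< p<p′ _ _ = ⊥-elim (shorter-root-impossible run root run′ root′ p<p′)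
  ... | tri> _ _ p′<p = ⊥-elim (shorter-root-impossible run′ root′ run root p′<p)
  ... | tri≈ _ refl _ with runs-equal run run′ i<t t+p≤1+j i′<t t+p≤1+j′
  ...   | refl , refl = refl

lookup-injective : ∀ {A : Set} {xs : List A} → Unique xs → ∀ {k k′} → lookup xs k ≡ lookup xs k′ → k ≡ k′
lookup-injective (_ ∷ _) {zero} {zero} _ = refl
lookup-injective (x∉ ∷ _) {zero} {suc k′} eq = ⊥-elim (All.lookup x∉ (∈-lookup k′) eq)
lookup-injective (x∉ ∷ _) {suc k} {zero} eq = ⊥-elim (All.lookup x∉ (∈-lookup k) (sym eq))
lookup-injective (_ ∷ unique) {suc k} {suc k′} eq = cong suc (lookup-injective unique eq)

length-unique-interval : ∀ {m n} {xs : List ℕ} → Unique xs → All (λ x → m ≤ x × x < n) xs → length xs ≤ n ∸ m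
length-unique-interval {m} {n} {xs} unique bounded = injective⇒≤ {f = index} index-injective
  where
    in-range : ∀ k → lookup xs k ∸ m < n ∸ m
    in-range k with All.lookup bounded (∈-lookup k)
    ... | m≤x , x<n = ∸-monoˡ-< x<n m≤x
    index : Fin (length xs) → Fin (n ∸ m)
    index k = fromℕ< (in-range k)
    index-injective : ∀ {k k′} → index k ≡ index k′ → k ≡ k′
    index-injective {k} {k′} eq = lookup-injective unique
      (∸-cancelʳ-≡ (proj₁ (All.lookup bounded (∈-lookup k))) (proj₁ (All.lookup bounded (∈-lookup k′)))
        (trans (sym (toℕ-fromℕ< (in-range k))) (trans (cong toℕ eq) (toℕ-fromℕ< (in-range k′)))))

fromℕᵘ : ℕ → ℚᵘ
fromℕᵘ n = mkℚᵘ (ℤ.+ n) 0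

fromℕᵘ-+ : ∀ m n → fromℕᵘ m ℚᵘ.+ fromℕᵘ n ℚᵘ.≃ fromℕᵘ (m + n)
fromℕᵘ-+ m n = *≡* (begin
  (ℤ.+ m ℤ.* ℤ.1ℤ ℤ.+ ℤ.+ n ℤ.* ℤ.1ℤ) ℤ.* ℤ.1ℤ ≡⟨ ℤᴾ.*-identityʳ _ ⟩
  ℤ.+ m ℤ.* ℤ.1ℤ ℤ.+ ℤ.+ n ℤ.* ℤ.1ℤ        ≡⟨ cong₂ ℤ._+_ (ℤᴾ.*-identityʳ (ℤ.+ m)) (ℤᴾ.*-identityʳ (ℤ.+ n)) ⟩
  ℤ.+ m ℤ.+ ℤ.+ n                          ≡⟨ ℤᴾ.pos-+ m n ⟨
  ℤ.+ (m + n)                              ≡⟨ ℤᴾ.*-identityʳ _ ⟨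
  ℤ.+ (m + n) ℤ.* ℤ.1ℤ                     ∎)
  where open ≡-Reasoning

ratio≤fromℕᵘ : ∀ ℓ p c → 0 < p → ℓ ≤ c * p → toℚᵘ (ratio ℓ p) ℚᵘ.≤ fromℕᵘ c
ratio≤fromℕᵘ ℓ (suc q) c _ ℓ≤cp =
  ℚᵘᴾ.≤-respˡ-≃ (ℚᵘᴾ.≃-sym (ℚᴾ.toℚᵘ-fromℚᵘ (mkℚᵘ (ℤ.+ ℓ) q)))
    (*≤* (subst₂ ℤ._≤_ (ℤᴾ.pos-* ℓ 1) (ℤᴾ.pos-* c (suc q)) (+≤+ ℓ*1≤cp)))
  where
    ℓ*1≤cp : ℓ * 1 ≤ c * suc q
    ℓ*1≤cp = subst (_≤ c * suc q) (sym (*-identityʳ ℓ)) ℓ≤cp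

sumExponents-∷ : ∀ r L m n → toℚᵘ (exponentOf r) ℚᵘ.≤ fromℕᵘ m → toℚᵘ (sumExponents L) ℚᵘ.≤ fromℕᵘ n →
                 toℚᵘ (sumExponents (r ∷ L)) ℚᵘ.≤ fromℕᵘ (m + n)
sumExponents-∷ r L m n r≤m L≤n =
  ℚᵘᴾ.≤-respˡ-≃ (ℚᵘᴾ.≃-sym (ℚᴾ.toℚᵘ-homo-+ (exponentOf r) (sumExponents L)))
    (ℚᵘᴾ.≤-respʳ-≃ (fromℕᵘ-+ m n) (ℚᵘᴾ.+-mono-≤ r≤m L≤n))

below-five-halves : ∀ {q : ℚ} {m n} → toℚᵘ q ℚᵘ.≤ fromℕᵘ (2 * m) → m ≤ n → 0 < n → q ℚ.< (ℤ.+ (5 * n)) ℚ./ 2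
below-five-halves {q} {m} {n} q≤2m m≤n 0<n =
  ℚᴾ.toℚᵘ-cancel-< (ℚᵘᴾ.≤-<-trans q≤2m
    (ℚᵘᴾ.<-respʳ-≃ (ℚᵘᴾ.≃-sym (ℚᴾ.toℚᵘ-fromℚᵘ (mkℚᵘ (ℤ.+ (5 * n)) 1)))
      (*<* (subst₂ ℤ._<_ (ℤᴾ.pos-* (2 * m) 2) (ℤᴾ.pos-* (5 * n) 1) (+<+ 4m<5n)))))
  where
    4m<5n : 2 * m * 2 < 5 * n * 1
    4m<5n = begin-strict
      2 * m * 2     ≤⟨ *-monoˡ-≤ 2 (*-monoʳ-≤ 2 m≤n) ⟩
      2 * n * 2     <⟨ m<m+n (2 * n * 2) 0<n ⟩
      2 * n * 2 + n ≡⟨ four-plus-one n ⟩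
      5 * n * 1     ∎
      where
        open ≤-Reasoning
        four-plus-one : ∀ n → 2 * n * 2 + n ≡ 5 * n * 1
        four-plus-one = solve-∀

module _ (w : ℕ → ℕ) where

  open Runs w

  lyndonRoots-of-runs : ∀ L → Unique L → (∀ {i j p} → (i , j , p) ∈ L → CubicRun i j p) →
    ∃ λ ts → Unique ts × All (λ t → ∃ λ r → r ∈ L × LyndonRootOf r t) ts ×
             toℚᵘ (sumExponents L) ℚᵘ.≤ fromℕᵘ (2 * length ts)
  lyndonRoots-of-runs [] _ _ = [] , [] , All.[] , *≤* ℤᴾ.≤-refl
  lyndonRoots-of-runs ((i , j , p) ∷ L) (r∉L ∷ unique) runs
    with lyndonRoots (runs (here refl)) | lyndonRoots-of-runs L unique (runs ∘ there)
  ... | ts , ts-unique , ts-roots , ℓ≤2|ts|p | ts′ , ts′-unique , ts′-roots , bound =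
    ts ++ ts′ , Unique.++⁺ ts-unique ts′-unique disjoint ,
    All.++⁺ (All.map (λ root → (i , j , p) , here refl , root) ts-roots)
            (All.map (λ { (r , r∈L , root) → r , there r∈L , root }) ts′-roots) ,
    subst (λ m → toℚᵘ (sumExponents ((i , j , p) ∷ L)) ℚᵘ.≤ fromℕᵘ m) 2|ts|+2|ts′|≡
      (sumExponents-∷ (i , j , p) L _ _
        (ratio≤fromℕᵘ (len i j) p (2 * length ts) (CubicRun.period-pos (runs (here refl))) ℓ≤2|ts|p) bound)
    where
      disjoint : ∀ {t} → ¬ (t ∈ ts × t ∈ ts′)
      disjoint (t∈ts , t∈ts′) with All.lookup ts′-roots t∈ts′
      ... | (i′ , j′ , p′) , r′∈L , root′ = All.lookup r∉L r′∈L
        (lyndonRoot-unique (runs (here refl)) (All.lookup ts-roots t∈ts) (runs (there r′∈L)) root′)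
      2|ts|+2|ts′|≡ : 2 * length ts + 2 * length ts′ ≡ 2 * length (ts ++ ts′)
      2|ts|+2|ts′|≡ = trans (sym (*-distribˡ-+ 2 (length ts) (length ts′))) (cong (2 *_) (sym (length-++ ts)))

code : ∀ {k} → Maybe (Fin k) → ℕ
code nothing  = 0
code (just x) = suc (toℕ x)

code-injective : ∀ {k} {x y : Maybe (Fin k)} → code x ≡ code y → x ≡ y
code-injective {x = nothing} {nothing} _  = refl
code-injective {x = just x}  {just y}  eq = cong just (toℕ-injective (suc-injective eq))

module _ {k n : ℕ} (u : Word k n) where

  -- letter m ↦ 1 + its index, and the sentinel 0 outside positions 1 .. n, so that every run is
  -- bordered by mismatches on both sides
  coded : ℕ → ℕ
  coded m = code (letter u m)

  coded-inside : ∀ m → m < n → coded (suc m) ≢ 0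
  coded-inside m m<n with m <? n
  ... | yes _   = λ ()
  ... | no  m≮n = ⊥-elim (m≮n m<n)

  coded-after : coded (suc n) ≡ 0
  coded-after with n <? n
  ... | yes n<n = ⊥-elim (<-irrefl refl n<n)
  ... | no  _   = refl

  coded-left-maximal : 1 ≤ i → 0 < p → p ≤ n → (2 ≤ i → letter u (i ∸ 1) ≢ letter u (i + p ∸ 1)) →
                       coded (i ∸ 1) ≢ coded (i ∸ 1 + p)
  coded-left-maximal {suc zero}    {suc p₀} _ _ p≤n _    eq = coded-inside p₀ p≤n (sym eq)
  coded-left-maximal {suc (suc _)}          _ _ _   left eq = left (s≤s (s≤s z≤n)) (code-injective eq)

  coded-right-maximal : 0 < p → p ≤ j → j ≤ n → (suc j ≤ n → letter u (suc j ∸ p) ≢ letter u (suc j)) →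
                        coded (suc j ∸ p) ≢ coded (suc j)
  coded-right-maximal {p} {j} 0<p p≤j j≤n right eq with m≤n⇒m<n∨m≡n j≤n
  ... | inj₁ j<n  = right j<n (code-injective eq)
  ... | inj₂ refl = coded-inside (j ∸ p) (∸-monoʳ-< 0<p p≤j) (begin
    coded (suc (j ∸ p)) ≡⟨ cong coded (+-∸-assoc 1 p≤j) ⟨
    coded (suc j ∸ p)   ≡⟨ eq ⟩
    coded (suc j)       ≡⟨ coded-after ⟩
    0                   ∎)
    where open ≡-Reasoning

  cubicRun : IsCubicRunWithPeriod u i j p → Runs.CubicRun coded i j p
  cubicRun {i} {j} {p} ((1≤i , i≤j , j≤n , ((0<p , p-period) , least) , _ , left , right) , 3p≤ℓ) = record
    { period-pos    = 0<p
    ; cubic         = subst (i + 3 * p ≤_) (m+[n∸m]≡n (≤-trans i≤j (n≤1+n j))) (+-monoʳ-≤ i 3p≤ℓ)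
    ; periodic      = λ x i≤x x+p≤j → cong code (p-period x i≤x x+p≤j)
    ; least-period  = λ q 0<q q<p q-period →
        <⇒≱ q<p (least q (0<q , λ x i≤x x+q≤j → code-injective (q-period x i≤x x+q≤j)))
    ; left-maximal  = coded-left-maximal 1≤i 0<p (≤-trans p≤j j≤n) left
    ; right-maximal = coded-right-maximal 0<p p≤j j≤n right
    }
    where
      p≤j : p ≤ j
      p≤j = ≤-trans (m≤m+n p (2 * p)) (≤-trans 3p≤ℓ (∸-monoʳ-≤ (suc j) 1≤i))

theorem3 : (k n : ℕ) → 1 ≤ n → (u : Word k n) → (L : List Triple) →
    EnumeratesCubicRuns u L → sumExponents L ℚ.< (ℤ.+ (5 * n)) ℚ./ 2
-- only that L lists distinct cubic runs is used, not that it lists all of them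
theorem3 k n 1≤n u L (unique , cubic , _)
  with lyndonRoots-of-runs (coded u) L unique (λ {i} {j} {p} r∈L → cubicRun u (cubic i j p r∈L))
... | ts , ts-unique , ts-roots , bound =
  below-five-halves bound (length-unique-interval ts-unique (All.map position ts-roots)) 1≤n
  where
    position : ∀ {t} → (∃ λ r → r ∈ L × Runs.LyndonRootOf (coded u) r t) → 1 ≤ t × t < suc n
    position {t} ((i , j , p) , r∈L , i<t , t+p≤1+j , _) with cubic i j p r∈L
    ... | (_ , _ , j≤n , ((0<p , _) , _) , _) , _ =
      <-≤-trans (s≤s z≤n) i<t , ≤-trans (≤-trans (m<m+n t 0<p) t+p≤1+j) (s≤s j≤n)
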